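{- Let $H$ be a graph with $r$ vertices and $m$ edges, $0<p<1$ and $\epsilon>0$. If a graph $G$ satisfies $\mathcal{P}^*_{H,p}(\epsilon)$, then it also satisfies $\mathcal{Q}_{H,p}((2^r-1)\epsilon)$.
   Context: A labeled copy of $H$ in $G$ is an injective map $\varphi:V(H)\to V(G)$ with $\varphi(u)\varphi(v)\in E(G)$ whenever $uv\in E(H)$. An $n$-vertex graph $G$ satisfies $\mathcal{P}^*_{H,p}(\epsilon)$ if for every $S\subseteq V(G)$ the number of labeled copies of $H$ with image in $S$ is within $\epsilon n^r$ of $p^m|S|^r$. $G$ satisfies $\mathcal{Q}_{H,p}(\epsilon)$ if for every $r$ pairwise disjoint subsets $V_1,\dots,V_r\subseteq V(G)$, the number of labeled copies of $H$ whose image contains exactly one vertex from each $V_i$ is within $\epsilon n^r$ of $p^m\, r!\prod_{i=1}^r|V_i|$.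
   Formalization: The parameters p and ε are rational. -}

module Defs where

open import Data.Nat as ℕ using (ℕ; zero; suc; _≡ᵇ_; _!; _∸_)
open import Data.Bool using (Bool; true; false; _∧_; not; if_then_else_)
open import Data.Fin using (Fin; zero; suc; _<?_; _≟_)
open import Data.Fin.Subset using (Subset; _∩_; Empty) renaming (∣_∣ to size)
open import Data.Vec using (lookup)
import Data.Vec.Functional as VF
open import Data.List using (List; []; _∷_; map; concatMap; allFin)
open import Data.Nat.ListAction using (product) renaming (sum to sumℕ)
open import Data.Integer using (+_)
open import Data.Rational using (ℚ; _*_; _-_; ∣_∣; _≤_; _<_; 0ℚ; 1ℚ; _/_)
open import Relation.Binary.PropositionalEquality using (_≡_; _≢_)
open import Relation.Nullary.Decidable using (⌊_⌋)

record Graph (n : ℕ) : Set where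
  field
    adj     : Fin n → Fin n → Bool
    adj-sym : ∀ u v → adj u v ≡ adj v u
    irrefl  : ∀ u → adj u u ≡ false
open Graph public

countB : {A : Set} → (A → Bool) → List A → ℕ
countB f []       = 0
countB f (x ∷ xs) = if f x then suc (countB f xs) else countB f xs

allB : (k : ℕ) → (Fin k → Bool) → Bool
allB zero    f = true
allB (suc k) f = f zero ∧ allB k (λ i → f (suc i))

_⇒ᵇ_ : Bool → Bool → Bool
a ⇒ᵇ b = not a Data.Bool.∨ b

numEdges : ∀ {r} → Graph r → ℕ
numEdges {r} H =
  sumℕ (map (λ u → countB (λ v → ⌊ u <? v ⌋ ∧ adj H u v) (allFin r)) (allFin r))


-- Enumeration of all maps Fin r → Fin n (each map occurs exactly once,
-- up to pointwise equality).
allMaps : (r n : ℕ) → List (Fin r → Fin n)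
allMaps zero    n = (λ ()) ∷ []
allMaps (suc r) n = concatMap (λ a → map (λ f → a VF.∷ f) (allMaps r n)) (allFin n)

injectiveB : ∀ {r n} → (Fin r → Fin n) → Bool
injectiveB {r} φ = allB r (λ i → allB r (λ j → not ⌊ i ≟ j ⌋ ⇒ᵇ not ⌊ φ i ≟ φ j ⌋))

preservesB : ∀ {r n} → Graph r → Graph n → (Fin r → Fin n) → Bool
preservesB {r} H G φ = allB r (λ i → allB r (λ j → adj H i j ⇒ᵇ adj G (φ i) (φ j)))

isCopyB : ∀ {r n} → Graph r → Graph n → (Fin r → Fin n) → Bool
isCopyB H G φ = injectiveB φ ∧ preservesB H G φ

imageInB : ∀ {r n} → Subset n → (Fin r → Fin n) → Bool
imageInB {r} S φ = allB r (λ i → lookup S (φ i))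

exactlyOneEachB : ∀ {r n} → (Fin r → Subset n) → (Fin r → Fin n) → Bool
exactlyOneEachB {r} V φ =
  allB r (λ i → countB (λ j → lookup (V i) (φ j)) (allFin r) ≡ᵇ 1)

copiesIn : ∀ {r n} → Graph r → Graph n → Subset n → ℕ
copiesIn {r} {n} H G S =
  countB (λ φ → isCopyB H G φ ∧ imageInB S φ) (allMaps r n)

copiesTransversal : ∀ {r n} → Graph r → Graph n → (Fin r → Subset n) → ℕ
copiesTransversal {r} {n} H G V =
  countB (λ φ → isCopyB H G φ ∧ exactlyOneEachB V φ) (allMaps r n)

ℕ→ℚ : ℕ → ℚ
ℕ→ℚ k = + k / 1

_^ℚ_ : ℚ → ℕ → ℚ
x ^ℚ zero  = 1ℚ
x ^ℚ suc k = x * (x ^ℚ k)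

Pstar : ∀ {r n} → Graph r → ℚ → ℚ → Graph n → Set
Pstar {r} {n} H p ε G =
  (S : Subset n) →
  ∣ ℕ→ℚ (copiesIn H G S) - (p ^ℚ numEdges H) * (ℕ→ℚ (size S) ^ℚ r) ∣
    ≤ ε * (ℕ→ℚ n ^ℚ r)

Q : ∀ {r n} → Graph r → ℚ → ℚ → Graph n → Set
Q {r} {n} H p ε G =
  (V : Fin r → Subset n) →
  (∀ i j → i ≢ j → Empty (V i ∩ V j)) →
  ∣ ℕ→ℚ (copiesTransversal H G V)
      - (p ^ℚ numEdges H) * ℕ→ℚ ((r !) ℕ.* product (map (λ i → size (V i)) (allFin r))) ∣
    ≤ ε * (ℕ→ℚ n ^ℚ r)

-- Write S_I = ⋃_{i ∈ I} V_i for I ⊆ {1, …, r}. Summing over I with signs (-1)^(r - |I|),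
-- inclusion–exclusion turns the copies with image in S_I into the copies meeting every V_i exactly
-- once, and turns |S_I|^r = (Σ_{i ∈ I} |V_i|)^r into r! ∏_i |V_i|, an r-th finite difference of x^r.
-- So the deviation in Q is the signed sum of the deviations in P* at the 2^r sets S_I, and the one
-- at S_∅ = ∅ vanishes.

module Submission where

open import Defs
open import Data.Nat as ℕ using (ℕ; zero; suc; _!; _^_; _∸_)
import Data.Nat.Properties as ℕ
import Data.Nat.Coprimality as Coprime
import Data.Integer as ℤ
import Data.Integer.Properties as ℤ
open import Data.Rational
open import Data.Rational.Properties
open import Data.Rational.Solver
open import Data.Bool using (Bool; true; false; T; _∧_; _∨_; not; if_then_else_)
open import Data.Bool.Properties using (∧-identityʳ; ∧-zeroʳ)
open import Data.Fin using (Fin; zero; suc)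
import Data.Fin.Properties as Fin
open import Data.Fin.Subset using (Subset; _∩_; Empty) renaming (∣_∣ to size)
open import Data.Vec using (Vec; []; _∷_; lookup; tabulate; replicate)
import Data.Vec.Properties as Vec
open import Data.List as List using ([]; _∷_; filterᵇ; allFin; map)
open import Data.Bool.ListAction using (all; any)
import Data.List.Properties as List
open import Data.Nat.ListAction using (product)
open import Data.Product using (Σ; _,_; proj₁; proj₂; _×_)
open import Data.Empty using (⊥-elim)
open import Function using (_∘_; flip)
open import Relation.Binary.PropositionalEquality
open import Relation.Nullary using (yes; no)
open import Algebra.Properties.CommutativeMonoid.Sum ℕ.+-0-commutativeMonoid
  using (sum; ∑-comm; ∑-distrib-+; sum-cong-≗)
open +-*-Solver
open import Algebra.Properties.Group +-0-group using (x∙y⁻¹≈ε⇒x≈y)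

ℕ→ℚ-normal : ∀ k → ℕ→ℚ k ≡ mkℚ (ℤ.+ k) 0 (Coprime.sym (Coprime.1-coprimeTo k))
ℕ→ℚ-normal k = normalize-coprime (Coprime.sym (Coprime.1-coprimeTo k))

ℕ→ℚ-homo-+ : ∀ a b → ℕ→ℚ (a ℕ.+ b) ≡ ℕ→ℚ a + ℕ→ℚ b
ℕ→ℚ-homo-+ a b rewrite ℕ→ℚ-normal a | ℕ→ℚ-normal b =
  /-cong (sym (cong₂ ℤ._+_ (ℤ.*-identityʳ (ℤ.+ a)) (ℤ.*-identityʳ (ℤ.+ b)))) refl

ℕ→ℚ-homo-* : ∀ a b → ℕ→ℚ (a ℕ.* b) ≡ ℕ→ℚ a * ℕ→ℚ b
ℕ→ℚ-homo-* a b rewrite ℕ→ℚ-normal a | ℕ→ℚ-normal b = /-cong (ℤ.pos-* a b) refl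

Bool→ℚ : Bool → ℚ
Bool→ℚ true  = 1ℚ
Bool→ℚ false = 0ℚ

ℕ→ℚ-countB-∷ : ∀ {X : Set} (f : X → Bool) x xs →
  ℕ→ℚ (countB f (x ∷ xs)) ≡ Bool→ℚ (f x) + ℕ→ℚ (countB f xs)
ℕ→ℚ-countB-∷ f x xs with f x
... | true  = ℕ→ℚ-homo-+ 1 (countB f xs)
... | false = sym (+-identityˡ _)

-- Alternating sums over the Boolean cube

-- alternatingSum r F = Σ_{I ⊆ Fin r} (-1)^(r - |I|) F I, subsets being characteristic vectors.
alternatingSum : (r : ℕ) → (Vec Bool r → ℚ) → ℚ
alternatingSum zero    F = F []
alternatingSum (suc r) F = alternatingSum r (F ∘ (true ∷_)) - alternatingSum r (F ∘ (false ∷_))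

alternatingSum-cong : ∀ r {F G : Vec Bool r → ℚ} → (∀ I → F I ≡ G I) →
  alternatingSum r F ≡ alternatingSum r G
alternatingSum-cong zero    F≗G = F≗G []
alternatingSum-cong (suc r) F≗G =
  cong₂ _-_ (alternatingSum-cong r (F≗G ∘ (true ∷_))) (alternatingSum-cong r (F≗G ∘ (false ∷_)))

alternatingSum-0 : ∀ r → alternatingSum r (λ _ → 0ℚ) ≡ 0ℚ
alternatingSum-0 zero = refl
alternatingSum-0 (suc r) rewrite alternatingSum-0 r = refl

alternatingSum-+ : ∀ r (F G : Vec Bool r → ℚ) →
  alternatingSum r (λ I → F I + G I) ≡ alternatingSum r F + alternatingSum r G
alternatingSum-+ zero F G = refl
alternatingSum-+ (suc r) F G
  rewrite alternatingSum-+ r (F ∘ (true ∷_)) (G ∘ (true ∷_))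
        | alternatingSum-+ r (F ∘ (false ∷_)) (G ∘ (false ∷_)) =
  solve 4 (λ a b x y → (a :+ x) :- (b :+ y) := (a :- b) :+ (x :- y)) refl
    (alternatingSum r (F ∘ (true ∷_))) (alternatingSum r (F ∘ (false ∷_)))
    (alternatingSum r (G ∘ (true ∷_))) (alternatingSum r (G ∘ (false ∷_)))

alternatingSum-- : ∀ r (F G : Vec Bool r → ℚ) →
  alternatingSum r (λ I → F I - G I) ≡ alternatingSum r F - alternatingSum r G
alternatingSum-- zero F G = refl
alternatingSum-- (suc r) F G
  rewrite alternatingSum-- r (F ∘ (true ∷_)) (G ∘ (true ∷_))
        | alternatingSum-- r (F ∘ (false ∷_)) (G ∘ (false ∷_)) =
  solve 4 (λ a b x y → (a :- x) :- (b :- y) := (a :- b) :- (x :- y)) refl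
    (alternatingSum r (F ∘ (true ∷_))) (alternatingSum r (F ∘ (false ∷_)))
    (alternatingSum r (G ∘ (true ∷_))) (alternatingSum r (G ∘ (false ∷_)))

alternatingSum-*ˡ : ∀ r c (F : Vec Bool r → ℚ) →
  alternatingSum r (λ I → c * F I) ≡ c * alternatingSum r F
alternatingSum-*ˡ zero c F = refl
alternatingSum-*ˡ (suc r) c F
  rewrite alternatingSum-*ˡ r c (F ∘ (true ∷_))
        | alternatingSum-*ˡ r c (F ∘ (false ∷_)) =
  solve 3 (λ c a b → c :* a :- c :* b := c :* (a :- b)) refl
    c (alternatingSum r (F ∘ (true ∷_))) (alternatingSum r (F ∘ (false ∷_)))

alternatingSum-countB : ∀ r {X : Set} (f : Vec Bool r → X → Bool) (g : X → Bool) →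
  (∀ x → alternatingSum r (λ I → Bool→ℚ (f I x)) ≡ Bool→ℚ (g x)) →
  ∀ xs → alternatingSum r (λ I → ℕ→ℚ (countB (f I) xs)) ≡ ℕ→ℚ (countB g xs)
alternatingSum-countB r f g pointwise [] = alternatingSum-0 r
alternatingSum-countB r f g pointwise (x ∷ xs) = begin
  alternatingSum r (λ I → ℕ→ℚ (countB (f I) (x ∷ xs)))
    ≡⟨ alternatingSum-cong r (λ I → ℕ→ℚ-countB-∷ (f I) x xs) ⟩
  alternatingSum r (λ I → Bool→ℚ (f I x) + ℕ→ℚ (countB (f I) xs))
    ≡⟨ alternatingSum-+ r _ _ ⟩
  alternatingSum r (λ I → Bool→ℚ (f I x)) + alternatingSum r (λ I → ℕ→ℚ (countB (f I) xs))
    ≡⟨ cong₂ _+_ (pointwise x) (alternatingSum-countB r f g pointwise xs) ⟩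
  Bool→ℚ (g x) + ℕ→ℚ (countB g xs)
    ≡⟨ sym (ℕ→ℚ-countB-∷ g x xs) ⟩
  ℕ→ℚ (countB g (x ∷ xs)) ∎
  where open ≡-Reasoning

2^[1+r]≡2^r+2^r : ∀ r → 2 ^ suc r ≡ 2 ^ r ℕ.+ 2 ^ r
2^[1+r]≡2^r+2^r r = cong (2 ^ r ℕ.+_) (ℕ.+-identityʳ (2 ^ r))

∣p-q∣≤[m+n]*B : ∀ m n p q B → ∣ p ∣ ≤ ℕ→ℚ m * B → ∣ q ∣ ≤ ℕ→ℚ n * B →
  ∣ p - q ∣ ≤ ℕ→ℚ (m ℕ.+ n) * B
∣p-q∣≤[m+n]*B m n p q B ∣p∣≤ ∣q∣≤ = begin
  ∣ p - q ∣                 ≤⟨ ∣p-q∣≤∣p∣+∣q∣ p q ⟩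
  ∣ p ∣ + ∣ q ∣             ≤⟨ +-mono-≤ ∣p∣≤ ∣q∣≤ ⟩
  ℕ→ℚ m * B + ℕ→ℚ n * B     ≡⟨ sym (*-distribʳ-+ B (ℕ→ℚ m) (ℕ→ℚ n)) ⟩
  (ℕ→ℚ m + ℕ→ℚ n) * B       ≡⟨ cong (_* B) (sym (ℕ→ℚ-homo-+ m n)) ⟩
  ℕ→ℚ (m ℕ.+ n) * B         ∎
  where open ≤-Reasoning

∣alternatingSum∣≤2^r* : ∀ r (F : Vec Bool r → ℚ) B → (∀ I → ∣ F I ∣ ≤ B) →
  ∣ alternatingSum r F ∣ ≤ ℕ→ℚ (2 ^ r) * B
∣alternatingSum∣≤2^r* zero F B ∣F∣≤B = ≤-trans (∣F∣≤B []) (≤-reflexive (sym (*-identityˡ B)))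
∣alternatingSum∣≤2^r* (suc r) F B ∣F∣≤B =
  subst (λ k → ∣ alternatingSum (suc r) F ∣ ≤ ℕ→ℚ k * B) (sym (2^[1+r]≡2^r+2^r r))
    (∣p-q∣≤[m+n]*B (2 ^ r) (2 ^ r) _ _ B
      (∣alternatingSum∣≤2^r* r _ B (∣F∣≤B ∘ (true ∷_)))
      (∣alternatingSum∣≤2^r* r _ B (∣F∣≤B ∘ (false ∷_))))

∣alternatingSum∣≤[2^r∸1]* : ∀ r (F : Vec Bool r → ℚ) B → F (replicate r false) ≡ 0ℚ →
  (∀ I → ∣ F I ∣ ≤ B) → ∣ alternatingSum r F ∣ ≤ ℕ→ℚ (2 ^ r ∸ 1) * B
∣alternatingSum∣≤[2^r∸1]* zero F B F∅≡0 ∣F∣≤B rewrite F∅≡0 = ≤-reflexive (sym (*-zeroˡ B))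
∣alternatingSum∣≤[2^r∸1]* (suc r) F B F∅≡0 ∣F∣≤B =
  subst (λ k → ∣ alternatingSum (suc r) F ∣ ≤ ℕ→ℚ k * B) 2^r+[2^r∸1]≡2^[1+r]∸1
    (∣p-q∣≤[m+n]*B (2 ^ r) (2 ^ r ∸ 1) _ _ B
      (∣alternatingSum∣≤2^r* r _ B (∣F∣≤B ∘ (true ∷_)))
      (∣alternatingSum∣≤[2^r∸1]* r _ B F∅≡0 (∣F∣≤B ∘ (false ∷_))))
  where
  2^r+[2^r∸1]≡2^[1+r]∸1 : 2 ^ r ℕ.+ (2 ^ r ∸ 1) ≡ 2 ^ suc r ∸ 1
  2^r+[2^r∸1]≡2^[1+r]∸1 =
    sym (trans (cong (_∸ 1) (2^[1+r]≡2^r+2^r r)) (ℕ.+-∸-assoc (2 ^ r) (ℕ.m^n>0 2 r)))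

-- Finite differences of polynomial functions

-- DegreeBelow d f: f is a polynomial function of degree < d, witnessed by its coefficients, highest first.
DegreeBelow : ℕ → (ℚ → ℚ) → Set
DegreeBelow zero    f = ∀ x → f x ≡ 0ℚ
DegreeBelow (suc d) f = Σ ℚ λ c → DegreeBelow d (λ x → f x - c * x ^ℚ d)

LeadingTerm : ℕ → ℚ → (ℚ → ℚ) → Set
LeadingTerm d c f = DegreeBelow d (λ x → f x - c * x ^ℚ d)

Δ : ℚ → (ℚ → ℚ) → ℚ → ℚ
Δ a f x = f (a + x) - f x

DegreeBelow-cong : ∀ d {f g : ℚ → ℚ} → (∀ x → f x ≡ g x) → DegreeBelow d f → DegreeBelow d g
DegreeBelow-cong zero    f≗g f≡0 x = trans (sym (f≗g x)) (f≡0 x)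
DegreeBelow-cong (suc d) f≗g (c , f′) = c , DegreeBelow-cong d (λ x → cong (_- c * x ^ℚ d) (f≗g x)) f′

DegreeBelow-0 : ∀ d → DegreeBelow d (λ _ → 0ℚ)
DegreeBelow-0 zero    x = refl
DegreeBelow-0 (suc d) = 0ℚ , DegreeBelow-cong d
  (λ x → sym (solve 1 (λ X → con 0ℚ :- con 0ℚ :* X := con 0ℚ) refl (x ^ℚ d))) (DegreeBelow-0 d)

DegreeBelow-+ : ∀ d {f g : ℚ → ℚ} → DegreeBelow d f → DegreeBelow d g → DegreeBelow d (λ x → f x + g x)
DegreeBelow-+ zero    f≡0 g≡0 x rewrite f≡0 x | g≡0 x = refl
DegreeBelow-+ (suc d) {f} {g} (b , f′) (c , g′) = b + c , DegreeBelow-cong d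
  (λ x → solve 5 (λ F G b c X → (F :- b :* X) :+ (G :- c :* X) := F :+ G :- (b :+ c) :* X) refl
           (f x) (g x) b c (x ^ℚ d))
  (DegreeBelow-+ d f′ g′)

DegreeBelow-*ˡ : ∀ d k {f : ℚ → ℚ} → DegreeBelow d f → DegreeBelow d (λ x → k * f x)
DegreeBelow-*ˡ zero    k f≡0 x rewrite f≡0 x = *-zeroʳ k
DegreeBelow-*ˡ (suc d) k {f} (c , f′) = k * c , DegreeBelow-cong d
  (λ x → solve 4 (λ k F c X → k :* (F :- c :* X) := k :* F :- k :* c :* X) refl k (f x) c (x ^ℚ d))
  (DegreeBelow-*ˡ d k f′)

DegreeBelow-suc : ∀ d {f : ℚ → ℚ} → DegreeBelow d f → DegreeBelow (suc d) f
DegreeBelow-suc d {f} f′ = 0ℚ , DegreeBelow-cong d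
  (λ x → solve 2 (λ F X → F := F :- con 0ℚ :* X) refl (f x) (x ^ℚ d)) f′

DegreeBelow-^ : ∀ d → DegreeBelow (suc d) (_^ℚ d)
DegreeBelow-^ d = 1ℚ , DegreeBelow-cong d
  (λ x → solve 1 (λ X → con 0ℚ := X :- con 1ℚ :* X) refl (x ^ℚ d)) (DegreeBelow-0 d)

DegreeBelow-[a+x]* : ∀ d a {g : ℚ → ℚ} → DegreeBelow d g → DegreeBelow (suc d) (λ x → (a + x) * g x)
DegreeBelow-[a+x]* zero a {g} g≡0 = 0ℚ , λ x → begin
  (a + x) * g x - 0ℚ * 1ℚ  ≡⟨ cong (λ y → (a + x) * y - 0ℚ * 1ℚ) (g≡0 x) ⟩
  (a + x) * 0ℚ - 0ℚ * 1ℚ   ≡⟨ solve 1 (λ y → y :* con 0ℚ :- con 0ℚ :* con 1ℚ := con 0ℚ) refl (a + x) ⟩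
  0ℚ                       ∎
  where open ≡-Reasoning
DegreeBelow-[a+x]* (suc d) a {g} (c , g′) = c , DegreeBelow-cong (suc d)
  (λ x → solve 5 (λ a x c G X → c :* a :* X :+ (a :+ x) :* (G :- c :* X) := (a :+ x) :* G :- c :* (x :* X))
           refl a x c (g x) (x ^ℚ d))
  (DegreeBelow-+ (suc d) {λ x → c * a * x ^ℚ d} {λ x → (a + x) * (g x - c * x ^ℚ d)}
    (DegreeBelow-*ˡ (suc d) (c * a) {_^ℚ d} (DegreeBelow-^ d)) (DegreeBelow-[a+x]* d a g′))

binomial-remainder : ∀ d a →
  DegreeBelow d (λ x → (a + x) ^ℚ suc d - x ^ℚ suc d - ℕ→ℚ (suc d) * a * x ^ℚ d)
binomial-remainder zero a x =
  solve 2 (λ a x → (a :+ x) :* con 1ℚ :- x :* con 1ℚ :- con 1ℚ :* a :* con 1ℚ := con 0ℚ) refl a x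
binomial-remainder (suc d) a = DegreeBelow-cong (suc d) expand
  (DegreeBelow-+ (suc d)
    {λ x → (a + x) * ((a + x) ^ℚ suc d - x ^ℚ suc d - ℕ→ℚ (suc d) * a * x ^ℚ d)}
    {λ x → ℕ→ℚ (suc d) * a * a * x ^ℚ d}
    (DegreeBelow-[a+x]* d a (binomial-remainder d a))
    (DegreeBelow-*ˡ (suc d) (ℕ→ℚ (suc d) * a * a) {_^ℚ d} (DegreeBelow-^ d)))
  where
  expand : ∀ x →
    (a + x) * ((a + x) ^ℚ suc d - x ^ℚ suc d - ℕ→ℚ (suc d) * a * x ^ℚ d) + ℕ→ℚ (suc d) * a * a * x ^ℚ d
      ≡ (a + x) ^ℚ suc (suc d) - x ^ℚ suc (suc d) - ℕ→ℚ (suc (suc d)) * a * x ^ℚ suc d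
  expand x = trans
    (solve 5 (λ a x N Y X → (a :+ x) :* (Y :- x :* X :- N :* a :* X) :+ N :* a :* a :* X
                             := (a :+ x) :* Y :- x :* (x :* X) :- (con 1ℚ :+ N) :* a :* (x :* X))
       refl a x (ℕ→ℚ (suc d)) ((a + x) ^ℚ suc d) (x ^ℚ d))
    (cong (λ N → (a + x) ^ℚ suc (suc d) - x ^ℚ suc (suc d) - N * a * x ^ℚ suc d)
      (sym (ℕ→ℚ-homo-+ 1 (suc d))))

DegreeBelow-Δ : ∀ d a {f : ℚ → ℚ} → DegreeBelow (suc d) f → DegreeBelow d (Δ a f)
DegreeBelow-Δ zero a {f} (c , f-c≡0) x =
  trans (cong₂ _-_ (x∙y⁻¹≈ε⇒x≈y (f (a + x)) (c * 1ℚ) (f-c≡0 (a + x)))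
                   (x∙y⁻¹≈ε⇒x≈y (f x) (c * 1ℚ) (f-c≡0 x)))
        (+-inverseʳ (c * 1ℚ))
DegreeBelow-Δ (suc d) a {f} (c , f′) = DegreeBelow-cong (suc d)
  (λ x → solve 5 (λ F₁ F₀ c P Q → (F₁ :- c :* P) :- (F₀ :- c :* Q) :+ c :* (P :- Q) := F₁ :- F₀)
           refl (f (a + x)) (f x) c ((a + x) ^ℚ suc d) (x ^ℚ suc d))
  (DegreeBelow-+ (suc d) {Δ a (λ y → f y - c * y ^ℚ suc d)}
    (DegreeBelow-suc d (DegreeBelow-Δ d a {λ y → f y - c * y ^ℚ suc d} f′))
    (DegreeBelow-*ˡ (suc d) c (ℕ→ℚ (suc d) * a , binomial-remainder d a)))

LeadingTerm-Δ : ∀ d c a {f : ℚ → ℚ} → LeadingTerm (suc d) c f →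
  LeadingTerm d (c * ℕ→ℚ (suc d) * a) (Δ a f)
LeadingTerm-Δ d c a {f} f′ = DegreeBelow-cong d
  (λ x → solve 8 (λ F₁ F₀ c P Q N a X → (F₁ :- c :* P) :- (F₀ :- c :* Q) :+ c :* (P :- Q :- N :* a :* X)
                                     := (F₁ :- F₀) :- c :* N :* a :* X)
           refl (f (a + x)) (f x) c ((a + x) ^ℚ suc d) (x ^ℚ suc d) (ℕ→ℚ (suc d)) a (x ^ℚ d))
  (DegreeBelow-+ d {Δ a (λ y → f y - c * y ^ℚ suc d)} (DegreeBelow-Δ d a {λ y → f y - c * y ^ℚ suc d} f′)
    (DegreeBelow-*ˡ d c (binomial-remainder d a)))

selectedSum : ∀ {r} → Vec Bool r → (Fin r → ℚ) → ℚ
selectedSum []      a = 0ℚ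
selectedSum (b ∷ I) a = (if b then a zero else 0ℚ) + selectedSum I (a ∘ suc)

selectedSum-cong : ∀ {r} (I : Vec Bool r) {a b : Fin r → ℚ} → (∀ i → a i ≡ b i) →
  selectedSum I a ≡ selectedSum I b
selectedSum-cong []          a≗b = refl
selectedSum-cong (true ∷ I)  a≗b = cong₂ _+_ (a≗b zero) (selectedSum-cong I (a≗b ∘ suc))
selectedSum-cong (false ∷ I) a≗b = cong (0ℚ +_) (selectedSum-cong I (a≗b ∘ suc))

productℚ : ∀ {r} → (Fin r → ℚ) → ℚ
productℚ {zero}  a = 1ℚ
productℚ {suc r} a = a zero * productℚ (a ∘ suc)

ℕ→ℚ-product : ∀ r (a : Fin r → ℕ) → ℕ→ℚ (product (List.tabulate a)) ≡ productℚ (ℕ→ℚ ∘ a)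
ℕ→ℚ-product zero    a = refl
ℕ→ℚ-product (suc r) a =
  trans (ℕ→ℚ-homo-* (a zero) _) (cong (ℕ→ℚ (a zero) *_) (ℕ→ℚ-product r (a ∘ suc)))

alternatingSum-LeadingTerm : ∀ r a c {f : ℚ → ℚ} → LeadingTerm r c f →
  alternatingSum r (λ I → f (selectedSum I a)) ≡ c * ℕ→ℚ (r !) * productℚ a
alternatingSum-LeadingTerm zero a c {f} f-c≡0 =
  trans (x∙y⁻¹≈ε⇒x≈y (f 0ℚ) (c * 1ℚ) (f-c≡0 0ℚ)) (sym (*-identityʳ (c * 1ℚ)))
alternatingSum-LeadingTerm (suc r) a c {f} f′ = begin
  alternatingSum r (λ I → f (a₀ + selectedSum I a′)) - alternatingSum r (λ I → f (0ℚ + selectedSum I a′))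
    ≡⟨ sym (alternatingSum-- r _ _) ⟩
  alternatingSum r (λ I → f (a₀ + selectedSum I a′) - f (0ℚ + selectedSum I a′))
    ≡⟨ alternatingSum-cong r (λ I → cong (λ y → f (a₀ + selectedSum I a′) - f y) (+-identityˡ _)) ⟩
  alternatingSum r (λ I → Δ a₀ f (selectedSum I a′))
    ≡⟨ alternatingSum-LeadingTerm r a′ (c * ℕ→ℚ (suc r) * a₀) {Δ a₀ f} (LeadingTerm-Δ r c a₀ {f} f′) ⟩
  c * ℕ→ℚ (suc r) * a₀ * ℕ→ℚ (r !) * productℚ a′
    ≡⟨ solve 5 (λ c N a M P → c :* N :* a :* M :* P := c :* (N :* M) :* (a :* P)) refl
         c (ℕ→ℚ (suc r)) a₀ (ℕ→ℚ (r !)) (productℚ a′) ⟩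
  c * (ℕ→ℚ (suc r) * ℕ→ℚ (r !)) * (a₀ * productℚ a′)
    ≡⟨ cong (λ N → c * N * (a₀ * productℚ a′)) (sym (ℕ→ℚ-homo-* (suc r) (r !))) ⟩
  c * ℕ→ℚ (suc r !) * productℚ a ∎
  where
  open ≡-Reasoning
  a₀ = a zero
  a′ = a ∘ suc

alternatingSum-selectedSum^r : ∀ r a →
  alternatingSum r (λ I → selectedSum I a ^ℚ r) ≡ ℕ→ℚ (r !) * productℚ a
alternatingSum-selectedSum^r r a = trans
  (alternatingSum-LeadingTerm r a 1ℚ {_^ℚ r} (DegreeBelow-cong r
    (λ x → sym (solve 1 (λ X → X :- con 1ℚ :* X := con 0ℚ) refl (x ^ℚ r))) (DegreeBelow-0 r)))
  (cong (_* productℚ a) (*-identityˡ (ℕ→ℚ (r !))))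

-- Inclusion–exclusion for a single map

anyB : (k : ℕ) → (Fin k → Bool) → Bool
anyB zero    f = false
anyB (suc k) f = f zero ∨ anyB k (f ∘ suc)

anyB-false : ∀ k (f : Fin k → Bool) → (∀ i → f i ≡ false) → anyB k f ≡ false
anyB-false zero    f f≡false = refl
anyB-false (suc k) f f≡false rewrite f≡false zero = anyB-false k (f ∘ suc) (f≡false ∘ suc)

allB-cong : ∀ k {f g : Fin k → Bool} → (∀ i → f i ≡ g i) → allB k f ≡ allB k g
allB-cong zero    f≗g = refl
allB-cong (suc k) f≗g = cong₂ _∧_ (f≗g zero) (allB-cong k (f≗g ∘ suc))

all-∨-filter : ∀ {C : Set} (P Q : C → Bool) js → all (λ j → P j ∨ Q j) js ≡ all Q (filterᵇ (not ∘ P) js)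
all-∨-filter P Q [] = refl
all-∨-filter P Q (j ∷ js) with P j
... | true  = all-∨-filter P Q js
... | false = cong (Q j ∧_) (all-∨-filter P Q js)

all-split-filter : ∀ {C : Set} (P Q : C → Bool) js →
  all Q js ≡ all Q (filterᵇ (not ∘ P) js) ∧ all Q (filterᵇ P js)
all-split-filter P Q [] = refl
all-split-filter P Q (j ∷ js) with P j
... | true  rewrite all-split-filter P Q js with Q j
...   | true  = refl
...   | false = sym (∧-zeroʳ _)
all-split-filter P Q (j ∷ js) | false rewrite all-split-filter P Q js with Q j
...   | true  = refl
...   | false = refl

all-filter-disjoint : ∀ {C : Set} (P Q : C → Bool) js → (∀ j → P j ≡ true → Q j ≡ false) →
  all Q (filterᵇ P js) ≡ not (any P js)
all-filter-disjoint P Q [] P⇒¬Q = refl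
all-filter-disjoint P Q (j ∷ js) P⇒¬Q with P j in Pj≡true
... | true rewrite P⇒¬Q j Pj≡true = refl
... | false = all-filter-disjoint P Q js P⇒¬Q

any-filter-disjoint : ∀ {C : Set} (P Q : C → Bool) js → (∀ j → P j ≡ true → Q j ≡ false) →
  any Q js ≡ any Q (filterᵇ (not ∘ P) js)
any-filter-disjoint P Q [] P⇒¬Q = refl
any-filter-disjoint P Q (j ∷ js) P⇒¬Q with P j in Pj≡true
... | true rewrite P⇒¬Q j Pj≡true = any-filter-disjoint P Q js P⇒¬Q
... | false = cong (Q j ∨_) (any-filter-disjoint P Q js P⇒¬Q)

RowsDisjoint : ∀ {r} {C : Set} → (Fin r → C → Bool) → Set
RowsDisjoint {r} M = ∀ i i′ j → M i j ≡ true → M i′ j ≡ true → i ≡ i′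

RowsDisjoint-tail : ∀ {r} {C : Set} {M : Fin (suc r) → C → Bool} → RowsDisjoint M → RowsDisjoint (M ∘ suc)
RowsDisjoint-tail disjoint i i′ j Mij Mi′j = Fin.suc-injective (disjoint (suc i) (suc i′) j Mij Mi′j)

RowsDisjoint-head : ∀ {r} {C : Set} {M : Fin (suc r) → C → Bool} → RowsDisjoint M →
  ∀ i j → M zero j ≡ true → M (suc i) j ≡ false
RowsDisjoint-head {M = M} disjoint i j M₀j with M (suc i) j in Mij
... | false = refl
... | true with () ← disjoint zero (suc i) j M₀j Mij

RowsDisjoint-head-uncovered : ∀ {r} {C : Set} {M : Fin (suc r) → C → Bool} → RowsDisjoint M →
  ∀ (I : Vec Bool r) j → M zero j ≡ true → anyB r (λ i → lookup I i ∧ M (suc i) j) ≡ false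
RowsDisjoint-head-uncovered {r} disjoint I j M₀j = anyB-false r _
  (λ i → trans (cong (lookup I i ∧_) (RowsDisjoint-head disjoint i j M₀j)) (∧-zeroʳ _))

-- Peel off row 0: if it misses js, the terms with and without it cancel; if it meets js, only the
-- terms containing it survive, and they reduce to the columns outside row 0.
alternatingSum-all-any : ∀ r {C : Set} (M : Fin r → C → Bool) js → RowsDisjoint M →
  alternatingSum r (λ I → Bool→ℚ (all (λ j → anyB r (λ i → lookup I i ∧ M i j)) js))
    ≡ Bool→ℚ (all (λ j → anyB r (flip M j)) js ∧ allB r (λ i → any (M i) js))
alternatingSum-all-any zero M js disjoint = cong Bool→ℚ (sym (∧-identityʳ (all (λ _ → false) js)))
alternatingSum-all-any (suc r) {C} M js disjoint = begin
  alternatingSum r (λ I → Bool→ℚ (all (λ j → M₀ j ∨ covered I j) js))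
    - alternatingSum r (λ I → Bool→ℚ (all (covered I) js))
    ≡⟨ cong₂ _-_ (alternatingSum-cong r (cong Bool→ℚ ∘ withHead))
                 (alternatingSum-cong r (cong Bool→ℚ ∘ withoutHead)) ⟩
  alternatingSum r (λ I → Bool→ℚ (coversRest I))
    - alternatingSum r (λ I → Bool→ℚ (coversRest I ∧ not (any M₀ js)))
    ≡⟨ difference (any M₀ js) ⟩
  Bool→ℚ (all (anyB r ∘ flip M′) rest ∧ (any M₀ js ∧ allB r (λ i → any (M′ i) rest)))
    ≡⟨ cong Bool→ℚ (cong₂ (λ x y → x ∧ (any M₀ js ∧ y))
         (sym (all-∨-filter M₀ (anyB r ∘ flip M′) js))
         (allB-cong r (λ i → sym (any-filter-disjoint M₀ (M′ i) js (RowsDisjoint-head disjoint i))))) ⟩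
  Bool→ℚ (all (λ j → M₀ j ∨ anyB r (flip M′ j)) js ∧ (any M₀ js ∧ allB r (λ i → any (M′ i) js))) ∎
  where
  open ≡-Reasoning
  M₀ = M zero
  M′ = M ∘ suc
  rest = filterᵇ (not ∘ M₀) js
  covered : Vec Bool r → C → Bool
  covered I j = anyB r (λ i → lookup I i ∧ M′ i j)
  coversRest : Vec Bool r → Bool
  coversRest I = all (covered I) rest
  withHead : ∀ I → all (λ j → M₀ j ∨ covered I j) js ≡ coversRest I
  withHead I = all-∨-filter M₀ (covered I) js
  withoutHead : ∀ I → all (covered I) js ≡ coversRest I ∧ not (any M₀ js)
  withoutHead I = trans (all-split-filter M₀ (covered I) js)
    (cong (coversRest I ∧_) (all-filter-disjoint M₀ (covered I) js (RowsDisjoint-head-uncovered disjoint I)))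
  difference : ∀ b →
    alternatingSum r (λ I → Bool→ℚ (coversRest I)) - alternatingSum r (λ I → Bool→ℚ (coversRest I ∧ not b))
      ≡ Bool→ℚ (all (anyB r ∘ flip M′) rest ∧ (b ∧ allB r (λ i → any (M′ i) rest)))
  difference false = begin
    alternatingSum r (λ I → Bool→ℚ (coversRest I)) - alternatingSum r (λ I → Bool→ℚ (coversRest I ∧ true))
      ≡⟨ cong (λ y → alternatingSum r (λ I → Bool→ℚ (coversRest I)) - y)
           (alternatingSum-cong r (λ I → cong Bool→ℚ (∧-identityʳ (coversRest I)))) ⟩
    alternatingSum r (λ I → Bool→ℚ (coversRest I)) - alternatingSum r (λ I → Bool→ℚ (coversRest I))
      ≡⟨ +-inverseʳ (alternatingSum r (λ I → Bool→ℚ (coversRest I))) ⟩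
    0ℚ
      ≡⟨ cong Bool→ℚ (sym (∧-zeroʳ (all (anyB r ∘ flip M′) rest))) ⟩
    Bool→ℚ (all (anyB r ∘ flip M′) rest ∧ false) ∎
  difference true = begin
    alternatingSum r (λ I → Bool→ℚ (coversRest I)) - alternatingSum r (λ I → Bool→ℚ (coversRest I ∧ false))
      ≡⟨ cong (λ y → alternatingSum r (λ I → Bool→ℚ (coversRest I)) - y)
           (trans (alternatingSum-cong r (λ I → cong Bool→ℚ (∧-zeroʳ (coversRest I)))) (alternatingSum-0 r)) ⟩
    alternatingSum r (λ I → Bool→ℚ (coversRest I)) - 0ℚ
      ≡⟨ +-identityʳ _ ⟩
    alternatingSum r (λ I → Bool→ℚ (coversRest I))
      ≡⟨ alternatingSum-all-any r M′ rest (RowsDisjoint-tail disjoint) ⟩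
    Bool→ℚ (all (anyB r ∘ flip M′) rest ∧ allB r (λ i → any (M′ i) rest)) ∎

Bool→ℕ : Bool → ℕ
Bool→ℕ true  = 1
Bool→ℕ false = 0

count : (k : ℕ) → (Fin k → Bool) → ℕ
count k f = sum (Bool→ℕ ∘ f)

count-cong : ∀ k {f g : Fin k → Bool} → (∀ i → f i ≡ g i) → count k f ≡ count k g
count-cong k f≗g = sum-cong-≗ (cong Bool→ℕ ∘ f≗g)

countB-tabulate : ∀ {A : Set} n (f : A → Bool) (g : Fin n → A) → countB f (List.tabulate g) ≡ count n (f ∘ g)
countB-tabulate zero    f g = refl
countB-tabulate (suc n) f g with f (g zero)
... | true  = cong suc (countB-tabulate n f (g ∘ suc))
... | false = countB-tabulate n f (g ∘ suc)

count-false : ∀ k (f : Fin k → Bool) → (∀ i → f i ≡ false) → count k f ≡ 0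
count-false zero    f f≡false = refl
count-false (suc k) f f≡false rewrite f≡false zero = count-false k (f ∘ suc) (f≡false ∘ suc)

anyB⇒count≥1 : ∀ k (f : Fin k → Bool) → anyB k f ≡ true → 1 ℕ.≤ count k f
anyB⇒count≥1 (suc k) f any≡true with f zero
... | true  = ℕ.s≤s ℕ.z≤n
... | false = anyB⇒count≥1 k (f ∘ suc) any≡true

count≥1⇒anyB : ∀ k (f : Fin k → Bool) → 1 ℕ.≤ count k f → anyB k f ≡ true
count≥1⇒anyB (suc k) f 1≤count with f zero
... | true  = refl
... | false = count≥1⇒anyB k (f ∘ suc) 1≤count

count≤1 : ∀ k (f : Fin k → Bool) → (∀ i i′ → f i ≡ true → f i′ ≡ true → i ≡ i′) →
  count k f ℕ.≤ 1
count≤1 zero    f unique = ℕ.z≤n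
count≤1 (suc k) f unique with f zero in f₀≡true
... | true  = ℕ.≤-reflexive (cong suc (count-false k (f ∘ suc) fsuc≡false))
  where
  fsuc≡false : ∀ i → f (suc i) ≡ false
  fsuc≡false i with f (suc i) in fi≡true
  ... | false = refl
  ... | true with () ← unique zero (suc i) f₀≡true fi≡true
... | false = count≤1 k (f ∘ suc) (λ i i′ fi fi′ → Fin.suc-injective (unique (suc i) (suc i′) fi fi′))

∑1≡n : ∀ n → sum {n} (λ _ → 1) ≡ n
∑1≡n zero    = refl
∑1≡n (suc n) = cong suc (∑1≡n n)

∑-mono-≤ : ∀ {n} {f g : Fin n → ℕ} → (∀ i → f i ℕ.≤ g i) → sum f ℕ.≤ sum g
∑-mono-≤ {zero}  f≤g = ℕ.z≤n
∑-mono-≤ {suc n} f≤g = ℕ.+-mono-≤ (f≤g zero) (∑-mono-≤ (f≤g ∘ suc))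

∑≡n∧≤1⇒≡1 : ∀ n (f : Fin n → ℕ) → (∀ i → f i ℕ.≤ 1) → sum f ≡ n → ∀ i → f i ≡ 1
∑≡n∧≤1⇒≡1 (suc n) f f≤1 ∑≡n i with f zero in f₀≡ | f≤1 zero
... | 0 | _ = ⊥-elim (ℕ.1+n≰n (begin
  suc n             ≡⟨ sym ∑≡n ⟩
  sum (f ∘ suc)     ≤⟨ ∑-mono-≤ (f≤1 ∘ suc) ⟩
  sum {n} (λ _ → 1) ≡⟨ ∑1≡n n ⟩
  n                 ∎))
  where open ℕ.≤-Reasoning
... | 1 | _ with i
...   | zero   = f₀≡
...   | suc i′ = ∑≡n∧≤1⇒≡1 n (f ∘ suc) (f≤1 ∘ suc) (ℕ.suc-injective ∑≡n) i′
∑≡n∧≤1⇒≡1 (suc n) f f≤1 ∑≡n i | suc (suc m) | ℕ.s≤s ()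

∑≡n∧≥1⇒≡1 : ∀ n (f : Fin n → ℕ) → (∀ i → 1 ℕ.≤ f i) → sum f ≡ n → ∀ i → f i ≡ 1
∑≡n∧≥1⇒≡1 (suc n) f 1≤f ∑≡n i with f zero in f₀≡ | 1≤f zero
... | 1 | _ with i
...   | zero   = f₀≡
...   | suc i′ = ∑≡n∧≥1⇒≡1 n (f ∘ suc) (1≤f ∘ suc) (ℕ.suc-injective ∑≡n) i′
∑≡n∧≥1⇒≡1 (suc n) f 1≤f ∑≡n i | suc (suc m) | _ = ⊥-elim (ℕ.<-irrefl refl (begin-strict
  n                       ≡⟨ sym (∑1≡n n) ⟩
  sum {n} (λ _ → 1)       ≤⟨ ∑-mono-≤ (1≤f ∘ suc) ⟩
  sum (f ∘ suc)           <⟨ ℕ.s≤s (ℕ.m≤n+m _ m) ⟩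
  suc m ℕ.+ sum (f ∘ suc) ≡⟨ ℕ.suc-injective ∑≡n ⟩
  n                       ∎))
  where open ℕ.≤-Reasoning

allB-elim : ∀ k (f : Fin k → Bool) → allB k f ≡ true → ∀ i → f i ≡ true
allB-elim (suc k) f all≡true i with f zero in f₀≡true
allB-elim (suc k) f all≡true zero    | true = f₀≡true
allB-elim (suc k) f all≡true (suc i) | true = allB-elim k (f ∘ suc) all≡true i

allB-intro : ∀ k (f : Fin k → Bool) → (∀ i → f i ≡ true) → allB k f ≡ true
allB-intro zero    f f≡true = refl
allB-intro (suc k) f f≡true rewrite f≡true zero = allB-intro k (f ∘ suc) (f≡true ∘ suc)

≡true⇔≡true⇒≡ : ∀ {a b : Bool} → (a ≡ true → b ≡ true) → (b ≡ true → a ≡ true) → a ≡ b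
≡true⇔≡true⇒≡ {false} {false} a⇒b b⇒a = refl
≡true⇔≡true⇒≡ {false} {true}  a⇒b b⇒a = b⇒a refl
≡true⇔≡true⇒≡ {true}  {false} a⇒b b⇒a = sym (a⇒b refl)
≡true⇔≡true⇒≡ {true}  {true}  a⇒b b⇒a = refl

∧≡true⇒ : ∀ {a b} → a ∧ b ≡ true → (a ≡ true) × (b ≡ true)
∧≡true⇒ {true} {true} _ = refl , refl

≡ᵇ1⇒≡1 : ∀ n → (n ℕ.≡ᵇ 1) ≡ true → n ≡ 1
≡ᵇ1⇒≡1 n n≡ᵇ1 = ℕ.≡ᵇ⇒≡ n 1 (subst T (sym n≡ᵇ1) _)

-- Pigeonhole on the double count of the 1s, using that the matrix is square.
rowsExactlyOne≡columnsHit∧rowsHit : ∀ r (M : Fin r → Fin r → Bool) → RowsDisjoint M →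
  allB r (λ i → count r (M i) ℕ.≡ᵇ 1) ≡ allB r (λ j → anyB r (flip M j)) ∧ allB r (λ i → anyB r (M i))
rowsExactlyOne≡columnsHit∧rowsHit r M disjoint = ≡true⇔≡true⇒≡ rowsOne⇒hit hit⇒rowsOne
  where
  column≤1 : ∀ j → count r (flip M j) ℕ.≤ 1
  column≤1 j = count≤1 r (flip M j) (λ i i′ → disjoint i i′ j)
  rows≡columns : sum (count r ∘ M) ≡ sum (count r ∘ flip M)
  rows≡columns = ∑-comm (λ i j → Bool→ℕ (M i j))
  rowsOne⇒hit : _ ≡ true → _ ≡ true
  rowsOne⇒hit rowsOne = cong₂ _∧_
    (allB-intro r _ (λ j → count≥1⇒anyB r _
      (ℕ.≤-reflexive (sym (∑≡n∧≤1⇒≡1 r _ column≤1 columns≡r j)))))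
    (allB-intro r _ (λ i → count≥1⇒anyB r _ (ℕ.≤-reflexive (sym (row≡1 i)))))
    where
    row≡1 : ∀ i → count r (M i) ≡ 1
    row≡1 i = ≡ᵇ1⇒≡1 _ (allB-elim r _ rowsOne i)
    columns≡r : sum (count r ∘ flip M) ≡ r
    columns≡r = trans (sym rows≡columns) (trans (sum-cong-≗ row≡1) (∑1≡n r))
  hit⇒rowsOne : _ ≡ true → _ ≡ true
  hit⇒rowsOne hit = allB-intro r _ (λ i → subst (λ k → (k ℕ.≡ᵇ 1) ≡ true) (sym (row≡1 i)) refl)
    where
    column≡1 : ∀ j → count r (flip M j) ≡ 1
    column≡1 j = ℕ.≤-antisym (column≤1 j) (anyB⇒count≥1 r _ (allB-elim r _ (proj₁ (∧≡true⇒ hit)) j))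
    rows≡r : sum (count r ∘ M) ≡ r
    rows≡r = trans rows≡columns (trans (sum-cong-≗ column≡1) (∑1≡n r))
    row≡1 : ∀ i → count r (M i) ≡ 1
    row≡1 = ∑≡n∧≥1⇒≡1 r _
      (λ i → anyB⇒count≥1 r (M i) (allB-elim r _ (proj₂ (∧≡true⇒ hit)) i)) rows≡r

all-tabulate : ∀ {A : Set} n (f : A → Bool) (g : Fin n → A) → all f (List.tabulate g) ≡ allB n (f ∘ g)
all-tabulate zero    f g = refl
all-tabulate (suc n) f g = cong (f (g zero) ∧_) (all-tabulate n f (g ∘ suc))

any-tabulate : ∀ {A : Set} n (f : A → Bool) (g : Fin n → A) → any f (List.tabulate g) ≡ anyB n (f ∘ g)
any-tabulate zero    f g = refl
any-tabulate (suc n) f g = cong (f (g zero) ∨_) (any-tabulate n f (g ∘ suc))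

size≡count : ∀ {n} (S : Subset n) → size S ≡ count n (lookup S)
size≡count []          = refl
size≡count (true ∷ S)  = cong suc (size≡count S)
size≡count (false ∷ S) = size≡count S

count-∨ : ∀ k (f g : Fin k → Bool) → (∀ i → f i ∧ g i ≡ false) →
  count k (λ i → f i ∨ g i) ≡ count k f ℕ.+ count k g
count-∨ k f g f∧g≡false = trans (sum-cong-≗ Bool→ℕ-∨) (∑-distrib-+ (Bool→ℕ ∘ f) (Bool→ℕ ∘ g))
  where
  Bool→ℕ-∨ : ∀ i → Bool→ℕ (f i ∨ g i) ≡ Bool→ℕ (f i) ℕ.+ Bool→ℕ (g i)
  Bool→ℕ-∨ i with f i | g i | f∧g≡false i
  ... | true  | false | _ = refl
  ... | false | _     | _ = refl

ℕ→ℚ-count-selected : ∀ r n (M : Fin r → Fin n → Bool) → RowsDisjoint M → ∀ I →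
  ℕ→ℚ (count n (λ v → anyB r (λ i → lookup I i ∧ M i v)))
    ≡ selectedSum I (λ i → ℕ→ℚ (count n (M i)))
ℕ→ℚ-count-selected zero n M disjoint [] = cong ℕ→ℚ (count-false n _ (λ _ → refl))
ℕ→ℚ-count-selected (suc r) n M disjoint (b ∷ I) = begin
  ℕ→ℚ (count n (λ v → (b ∧ M zero v) ∨ rest v))
    ≡⟨ cong ℕ→ℚ (count-∨ n _ rest disjointFromRest) ⟩
  ℕ→ℚ (count n (λ v → b ∧ M zero v) ℕ.+ count n rest)
    ≡⟨ ℕ→ℚ-homo-+ (count n (λ v → b ∧ M zero v)) (count n rest) ⟩
  ℕ→ℚ (count n (λ v → b ∧ M zero v)) + ℕ→ℚ (count n rest)
    ≡⟨ cong₂ _+_ (firstTerm b) (ℕ→ℚ-count-selected r n (M ∘ suc) (RowsDisjoint-tail disjoint) I) ⟩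
  (if b then ℕ→ℚ (count n (M zero)) else 0ℚ) + selectedSum I (λ i → ℕ→ℚ (count n (M (suc i)))) ∎
  where
  open ≡-Reasoning
  rest : Fin n → Bool
  rest v = anyB r (λ i → lookup I i ∧ M (suc i) v)
  disjointFromRest : ∀ v → (b ∧ M zero v) ∧ rest v ≡ false
  disjointFromRest v with b ∧ M zero v in b∧M₀v
  ... | false = refl
  ... | true  = RowsDisjoint-head-uncovered disjoint I v (proj₂ (∧≡true⇒ b∧M₀v))
  firstTerm : ∀ b → ℕ→ℚ (count n (λ v → b ∧ M zero v)) ≡ (if b then ℕ→ℚ (count n (M zero)) else 0ℚ)
  firstTerm true  = refl
  firstTerm false = cong ℕ→ℚ (count-false n _ (λ _ → refl))

deviation : ∀ {r n} → Graph r → ℚ → Graph n → Subset n → ℚ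
deviation {r} H p G S = ℕ→ℚ (copiesIn H G S) - (p ^ℚ numEdges H) * (ℕ→ℚ (size S) ^ℚ r)

countB-false : ∀ {X : Set} (f : X → Bool) xs → (∀ x → f x ≡ false) → countB f xs ≡ 0
countB-false f []       f≡false = refl
countB-false f (x ∷ xs) f≡false rewrite f≡false x = countB-false f xs f≡false

deviation-∅ : ∀ {r n} (H : Graph r) p (G : Graph n) (S : Subset n) → (∀ v → lookup S v ≡ false) →
  deviation H p G S ≡ 0ℚ
deviation-∅ {zero}  H p G S S≡∅ = refl
deviation-∅ {suc r} {n} H p G S S≡∅ = begin
  ℕ→ℚ (copiesIn H G S) - (p ^ℚ numEdges H) * (ℕ→ℚ (size S) ^ℚ suc r)
    ≡⟨ cong₂ (λ c s → ℕ→ℚ c - (p ^ℚ numEdges H) * (ℕ→ℚ s ^ℚ suc r)) noCopies (size≡count S) ⟩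
  0ℚ - (p ^ℚ numEdges H) * (ℕ→ℚ (count n (lookup S)) ^ℚ suc r)
    ≡⟨ cong (λ s → 0ℚ - (p ^ℚ numEdges H) * (ℕ→ℚ s ^ℚ suc r)) (count-false n (lookup S) S≡∅) ⟩
  0ℚ - (p ^ℚ numEdges H) * (0ℚ * 0ℚ ^ℚ r)
    ≡⟨ solve 2 (λ q z → con 0ℚ :- q :* (con 0ℚ :* z) := con 0ℚ) refl (p ^ℚ numEdges H) (0ℚ ^ℚ r) ⟩
  0ℚ ∎
  where
  open ≡-Reasoning
  noCopies : copiesIn H G S ≡ 0
  noCopies = countB-false _ (allMaps (suc r) n)
    (λ φ → trans (cong (λ b → isCopyB H G φ ∧ (b ∧ imageInB S (φ ∘ suc))) (S≡∅ (φ zero))) (∧-zeroʳ _))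

selectedUnion : ∀ {r n} → (Fin r → Subset n) → Vec Bool r → Subset n
selectedUnion {r} V I = tabulate (λ v → anyB r (λ i → lookup I i ∧ lookup (V i) v))

selectedUnion-∅ : ∀ {r n} (V : Fin r → Subset n) v → lookup (selectedUnion V (replicate r false)) v ≡ false
selectedUnion-∅ {r} V v = trans (Vec.lookup∘tabulate _ v)
  (anyB-false r _ (λ i → cong (_∧ lookup (V i) v) (Vec.lookup-replicate i false)))

module _ {r n : ℕ} (V : Fin r → Subset n) (disjoint : ∀ i j → i ≢ j → Empty (V i ∩ V j)) where

  membership-RowsDisjoint : RowsDisjoint (λ i → lookup (V i))
  membership-RowsDisjoint i i′ v v∈Vi v∈Vi′ with i Fin.≟ i′
  ... | yes i≡i′ = i≡i′
  ... | no  i≢i′ = ⊥-elim (disjoint i i′ i≢i′ (v , Vec.lookup⇒[]= v (V i ∩ V i′)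
          (trans (Vec.lookup-zipWith _∧_ v (V i) (V i′)) (cong₂ _∧_ v∈Vi v∈Vi′))))

  exactlyOneEach≡alternatingSum : ∀ (φ : Fin r → Fin n) →
    Bool→ℚ (exactlyOneEachB V φ) ≡ alternatingSum r (λ I → Bool→ℚ (imageInB (selectedUnion V I) φ))
  exactlyOneEach≡alternatingSum φ = begin
    Bool→ℚ (allB r (λ i → countB (M i) (allFin r) ℕ.≡ᵇ 1))
      ≡⟨ cong Bool→ℚ (allB-cong r (λ i → cong (ℕ._≡ᵇ 1) (countB-tabulate r (M i) (λ j → j)))) ⟩
    Bool→ℚ (allB r (λ i → count r (M i) ℕ.≡ᵇ 1))
      ≡⟨ cong Bool→ℚ (rowsExactlyOne≡columnsHit∧rowsHit r M disjointRows) ⟩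
    Bool→ℚ (allB r (λ j → anyB r (flip M j)) ∧ allB r (λ i → anyB r (M i)))
      ≡⟨ cong Bool→ℚ (sym (cong₂ _∧_ (all-tabulate r (λ j → anyB r (flip M j)) (λ j → j))
                                     (allB-cong r (λ i → any-tabulate r (M i) (λ j → j))))) ⟩
    Bool→ℚ (all (λ j → anyB r (flip M j)) (allFin r) ∧ allB r (λ i → any (M i) (allFin r)))
      ≡⟨ sym (alternatingSum-all-any r M (allFin r) disjointRows) ⟩
    alternatingSum r (λ I → Bool→ℚ (all (λ j → anyB r (λ i → lookup I i ∧ M i j)) (allFin r)))
      ≡⟨ alternatingSum-cong r (λ I → cong Bool→ℚ (trans (all-tabulate r _ (λ j → j))
           (allB-cong r (λ j → sym (Vec.lookup∘tabulate _ (φ j)))))) ⟩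
    alternatingSum r (λ I → Bool→ℚ (imageInB (selectedUnion V I) φ)) ∎
    where
    open ≡-Reasoning
    M : Fin r → Fin r → Bool
    M i j = lookup (V i) (φ j)
    disjointRows : RowsDisjoint M
    disjointRows i i′ j = membership-RowsDisjoint i i′ (φ j)

  ℕ→ℚ-size-selectedUnion : ∀ I → ℕ→ℚ (size (selectedUnion V I)) ≡ selectedSum I (ℕ→ℚ ∘ size ∘ V)
  ℕ→ℚ-size-selectedUnion I = begin
    ℕ→ℚ (size (selectedUnion V I))
      ≡⟨ cong ℕ→ℚ (trans (size≡count (selectedUnion V I)) (count-cong n (Vec.lookup∘tabulate _))) ⟩
    ℕ→ℚ (count n (λ v → anyB r (λ i → lookup I i ∧ lookup (V i) v)))
      ≡⟨ ℕ→ℚ-count-selected r n (λ i → lookup (V i)) membership-RowsDisjoint I ⟩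
    selectedSum I (λ i → ℕ→ℚ (count n (lookup (V i))))
      ≡⟨ selectedSum-cong I (λ i → cong ℕ→ℚ (sym (size≡count (V i)))) ⟩
    selectedSum I (ℕ→ℚ ∘ size ∘ V) ∎
    where open ≡-Reasoning

  alternatingSum-size^r : alternatingSum r (λ I → ℕ→ℚ (size (selectedUnion V I)) ^ℚ r)
    ≡ ℕ→ℚ ((r !) ℕ.* product (map (size ∘ V) (allFin r)))
  alternatingSum-size^r = begin
    alternatingSum r (λ I → ℕ→ℚ (size (selectedUnion V I)) ^ℚ r)
      ≡⟨ alternatingSum-cong r (λ I → cong (_^ℚ r) (ℕ→ℚ-size-selectedUnion I)) ⟩
    alternatingSum r (λ I → selectedSum I (ℕ→ℚ ∘ size ∘ V) ^ℚ r)
      ≡⟨ alternatingSum-selectedSum^r r (ℕ→ℚ ∘ size ∘ V) ⟩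
    ℕ→ℚ (r !) * productℚ (ℕ→ℚ ∘ size ∘ V)
      ≡⟨ cong (ℕ→ℚ (r !) *_) (sym (ℕ→ℚ-product r (size ∘ V))) ⟩
    ℕ→ℚ (r !) * ℕ→ℚ (product (List.tabulate (size ∘ V)))
      ≡⟨ cong (λ xs → ℕ→ℚ (r !) * ℕ→ℚ (product xs)) (sym (List.map-tabulate (λ i → i) (size ∘ V))) ⟩
    ℕ→ℚ (r !) * ℕ→ℚ (product (map (size ∘ V) (allFin r)))
      ≡⟨ sym (ℕ→ℚ-homo-* (r !) _) ⟩
    ℕ→ℚ ((r !) ℕ.* product (map (size ∘ V) (allFin r))) ∎
    where open ≡-Reasoning

  alternatingSum-copiesIn : ∀ (H : Graph r) (G : Graph n) →
    alternatingSum r (λ I → ℕ→ℚ (copiesIn H G (selectedUnion V I))) ≡ ℕ→ℚ (copiesTransversal H G V)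
  alternatingSum-copiesIn H G = alternatingSum-countB r _ _ pointwise (allMaps r n)
    where
    pointwise : ∀ φ → alternatingSum r (λ I → Bool→ℚ (isCopyB H G φ ∧ imageInB (selectedUnion V I) φ))
      ≡ Bool→ℚ (isCopyB H G φ ∧ exactlyOneEachB V φ)
    pointwise φ with isCopyB H G φ
    ... | true  = sym (exactlyOneEach≡alternatingSum φ)
    ... | false = alternatingSum-0 r

  alternatingSum-deviation : ∀ (H : Graph r) p (G : Graph n) →
    alternatingSum r (deviation H p G ∘ selectedUnion V)
      ≡ ℕ→ℚ (copiesTransversal H G V)
        - (p ^ℚ numEdges H) * ℕ→ℚ ((r !) ℕ.* product (map (size ∘ V) (allFin r)))
  alternatingSum-deviation H p G = begin
    alternatingSum r (deviation H p G ∘ selectedUnion V)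
      ≡⟨ alternatingSum-- r _ _ ⟩
    alternatingSum r (λ I → ℕ→ℚ (copiesIn H G (selectedUnion V I)))
      - alternatingSum r (λ I → q * (ℕ→ℚ (size (selectedUnion V I)) ^ℚ r))
      ≡⟨ cong₂ _-_ (alternatingSum-copiesIn H G) (alternatingSum-*ˡ r q _) ⟩
    ℕ→ℚ (copiesTransversal H G V) - q * alternatingSum r (λ I → ℕ→ℚ (size (selectedUnion V I)) ^ℚ r)
      ≡⟨ cong (λ x → ℕ→ℚ (copiesTransversal H G V) - q * x) alternatingSum-size^r ⟩
    ℕ→ℚ (copiesTransversal H G V) - q * ℕ→ℚ ((r !) ℕ.* product (map (size ∘ V) (allFin r))) ∎
    where
    open ≡-Reasoning
    q = p ^ℚ numEdges H

lemma3p1 : {r : ℕ} (H : Graph r) (p ε : ℚ) → 0ℚ < p → p < 1ℚ → 0ℚ < ε →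
  {n : ℕ} (G : Graph n) → Pstar H p ε G → Q H p (ℕ→ℚ (2 ^ r ∸ 1) * ε) G
lemma3p1 {r} H p ε _ _ _ G pstar V disjoint =
  subst₂ _≤_ (cong ∣_∣ (alternatingSum-deviation V disjoint H p G)) (sym (*-assoc (ℕ→ℚ (2 ^ r ∸ 1)) ε _))
    (∣alternatingSum∣≤[2^r∸1]* r _ _
      (deviation-∅ H p G (selectedUnion V (replicate r false)) (selectedUnion-∅ V))
      (pstar ∘ selectedUnion V))
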